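{- Let $n\ge 3$ and $T_{3,n}=C_3\Box C_n$. Then $\chi(T_{3,n}^2)=6$ if $n$ is even; $\chi(T_{3,n}^2)=7$ if $n$ is odd and $n\ge 7$; $\chi(T_{3,5}^2)=8$; and $\chi(T_{3,3}^2)=9$.
   Context: $C_k$ denotes the cycle on $k$ vertices; $\Box$ is the Cartesian product of graphs. The square $G^2$ of a graph $G$ has vertex set $V(G)$, two distinct vertices being adjacent iff their distance in $G$ is at most 2. $\chi$ is the chromatic number. -}

module Defs where

open import Data.Nat using (ℕ; zero; suc; _+_; _∸_; _≤_)
open import Data.Fin using (Fin; toℕ)
open import Data.Product using (Σ; _×_; ∃)
open import Data.Sum using (_⊎_)
open import Relation.Binary.PropositionalEquality using (_≡_; _≢_)

record Graph : Set₁ where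
  field
    V   : Set
    Adj : V → V → Set
open Graph public

-- The cycle C_k on vertex set {0,…,k-1}: i ~ j iff j = i+1 mod k (or vice versa).
-- (Written without mod; for k ≥ 3 this is exactly the k-cycle.)
CycAdj : (k : ℕ) → Fin k → Fin k → Set
CycAdj k i j =
  (suc (toℕ i) ≡ toℕ j) ⊎ (suc (toℕ j) ≡ toℕ i)
  ⊎ ((toℕ i ≡ 0 × toℕ j ≡ k ∸ 1) ⊎ (toℕ j ≡ 0 × toℕ i ≡ k ∸ 1))

C : ℕ → Graph
C k = record { V = Fin k ; Adj = CycAdj k }

_□_ : Graph → Graph → Graph
G □ H = record
  { V = V G × V H
  ; Adj = λ p q → (Adj G (Data.Product.proj₁ p) (Data.Product.proj₁ q) × Data.Product.proj₂ p ≡ Data.Product.proj₂ q)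
                ⊎ (Data.Product.proj₁ p ≡ Data.Product.proj₁ q × Adj H (Data.Product.proj₂ p) (Data.Product.proj₂ q))
  }

square : Graph → Graph
square G = record
  { V = V G
  ; Adj = λ u v → u ≢ v × (Adj G u v ⊎ Σ (V G) (λ w → Adj G u w × Adj G w v))
  }

Colorable : Graph → ℕ → Set
Colorable G k = Σ (V G → Fin k) (λ c → ∀ u v → Adj G u v → c u ≢ c v)

ChromaticNumber : Graph → ℕ → Set
ChromaticNumber G k = Colorable G k × (∀ m → Colorable G m → k ≤ m)

T3 : ℕ → Graph
T3 n = C 3 □ C n

module Submission where

open import Defs
open import Data.Nat using (ℕ; _≤_)
open import Data.Nat.Divisibility using (_∣_)
open import Data.Product using (_×_)
open import Relation.Nullary using (¬_)

-- Upper bounds.  A colouring of T_{3,n}² is built column by column: a column colouring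
-- assigns colours to the three rows of a column, and a sequence c 0, c 1, … of them colours
-- T_{3,n}² properly as soon as every window (c i, c (i+1), c (i+2)) with i < n is valid
-- (c i injective, c i and c (i+1) disjoint, c i and c (i+2) different in every row) and the
-- sequence wraps around after n columns (`pattern-colouring`).  Such patterns are written as
-- cyclic words of columns whose validity is decided by computation; inserting a valid 4-cycle
-- into a cyclic word keeps it valid (`insert-block`), which turns two base words into the whole
-- family for even n (6 colours) and for odd n ≥ 7 (7 colours).  n = 5 and n = 3 are single words.
--
-- Lower bounds.  All are pigeonhole arguments for injections into Fin m: two adjacent columns
-- form a 6-clique; T_{3,3}² is complete; in a 6-colouring every colour of column i reappears in
-- column i+2, which is impossible around an odd cycle; and a 7-colouring of T_{3,5}² would need
-- eight colours on two columns plus two rows of the last column.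

open import Data.Nat using (zero; suc; _+_; _*_; _∸_; _<_; s≤s; _≤?_)
open import Data.Nat.Properties using (+-comm; +-identityʳ; suc-injective; ≤-refl; <-irrefl; <⇒≤; ≰⇒>; 1+n≢n)
open import Data.Nat.Divisibility using (divides; m%n≡0⇒n∣m)
open import Data.Nat.DivMod using (_/_; _%_; m≡m%n+[m/n]*n; m%n<n)
open import Data.Fin using (Fin; toℕ; #_; fromℕ<; inject≤) renaming (zero to fz; suc to fs)
open import Data.Fin.Properties
  using (_≟_; all?; any?; toℕ<n; toℕ-injective; toℕ-fromℕ<; inject≤-injective; injective⇒≤; *↔×; +↔⊎)
open import Data.Vec using (Vec; []; _∷_; _++_)
open import Data.Product using (Σ; ∃; _,_; proj₁; proj₂)
open import Data.Product.Properties using (≡-dec)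
open import Data.Sum using (_⊎_; inj₁; inj₂; [_,_]′)
open import Data.Sum.Function.Propositional using (_⊎-↔_)
open import Data.Unit using (⊤; tt)
open import Data.Empty using (⊥; ⊥-elim)
open import Function using (_∘_)
open import Function.Bundles using (_↔_; Injection)
open import Function.Definitions using (Injective)
open import Function.Properties.Inverse using (↔⇒↣)
open import Function.Construct.Composition using (_↔-∘_)
open import Function.Construct.Identity using (↔-id)
open import Relation.Binary.Definitions using (DecidableEquality)
open import Relation.Nullary using (Dec; yes; no; ¬?; _×-dec_)
open import Relation.Nullary.Decidable using (from-yes; _→-dec_; map′; decidable-stable)
open import Relation.Binary.PropositionalEquality using (_≡_; _≢_; refl; sym; trans; cong; subst)

Column : ℕ → Set
Column K = Fin 3 → Fin K

-- The three conditions a proper colouring of T_{3,n}² imposes on columns at distance 0, 1, 2.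
Rainbow : ∀ {K} → Column K → Set
Rainbow x = ∀ a b → a ≢ b → x a ≢ x b

Disjoint : ∀ {K} → Column K → Column K → Set
Disjoint x y = ∀ a b → x a ≢ y b

RowDistinct : ∀ {K} → Column K → Column K → Set
RowDistinct x z = ∀ a → x a ≢ z a

Window : ∀ {K} → Column K → Column K → Column K → Set
Window x y z = Rainbow x × Disjoint x y × RowDistinct x z

disjoint-sym : ∀ {K} {x y : Column K} → Disjoint x y → Disjoint y x
disjoint-sym d a b e = d b a (sym e)

rowDistinct-sym : ∀ {K} {x z : Column K} → RowDistinct x z → RowDistinct z x
rowDistinct-sym d a e = d a (sym e)

-- A cyclic pattern of length n: a sequence of column colourings whose windows starting at
-- 0, …, n-1 are valid and whose columns n, n+1 (the ones these windows reach past the end)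
-- repeat columns 0, 1.
record CyclicPattern (K n : ℕ) (c : ℕ → Column K) : Set where
  field
    window : ∀ i → i < n → Window (c i) (c (suc i)) (c (suc (suc i)))
    wrap₀  : c n ≡ c 0
    wrap₁  : c (suc n) ≡ c 1

Step : ℕ → ℕ → ℕ → Set
Step n i j = suc i ≡ j ⊎ (i ≡ n ∸ 1 × j ≡ 0)

cycAdj⇒step : ∀ {n} {j l : Fin n} → CycAdj n j l → Step n (toℕ j) (toℕ l) ⊎ Step n (toℕ l) (toℕ j)
cycAdj⇒step (inj₁ e) = inj₁ (inj₁ e)
cycAdj⇒step (inj₂ (inj₁ e)) = inj₂ (inj₁ e)
cycAdj⇒step (inj₂ (inj₂ (inj₁ (j≡0 , l≡last)))) = inj₂ (inj₂ (l≡last , j≡0))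
cycAdj⇒step (inj₂ (inj₂ (inj₂ (l≡0 , j≡last)))) = inj₁ (inj₂ (j≡last , l≡0))

last-step : ∀ {n i} → i ≡ n ∸ 1 → i < n → suc i ≡ n
last-step {suc n} refl _ = refl

last-no-next : ∀ {n i} → i ≡ n ∸ 1 → suc i < n → ⊥
last-no-next {zero} _ ()
last-no-next {suc n} refl = <-irrefl refl

step-injective : ∀ {n i j k} → Step n i k → Step n j k → i ≡ j
step-injective (inj₁ refl) (inj₁ e) = sym (suc-injective e)
step-injective (inj₁ refl) (inj₂ (_ , ()))
step-injective (inj₂ (_ , refl)) (inj₁ ())
step-injective (inj₂ (i≡last , _)) (inj₂ (j≡last , _)) = trans i≡last (sym j≡last)

step-functional : ∀ {n i j k} → Step n i j → Step n i k → j < n → k < n → j ≡ k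
step-functional (inj₁ refl) (inj₁ refl) _ _ = refl
step-functional (inj₁ refl) (inj₂ (i≡last , _)) j<n _ = ⊥-elim (last-no-next i≡last j<n)
step-functional (inj₂ (i≡last , _)) (inj₁ refl) _ k<n = ⊥-elim (last-no-next i≡last k<n)
step-functional (inj₂ (_ , refl)) (inj₂ (_ , refl)) _ _ = refl

module _ {K n : ℕ} {c : ℕ → Column K} (P : CyclicPattern K n c) where
  open CyclicPattern P

  shift₀ : ∀ {i j} → Step n i j → i < n → c (suc i) ≡ c j
  shift₀ (inj₁ refl) _ = refl
  shift₀ (inj₂ (i≡last , refl)) i<n = trans (cong c (last-step i≡last i<n)) wrap₀

  shift₁ : ∀ {i j} → Step n i j → i < n → c (suc (suc i)) ≡ c (suc j)
  shift₁ (inj₁ refl) _ = refl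
  shift₁ (inj₂ (i≡last , refl)) i<n = trans (cong (c ∘ suc) (last-step i≡last i<n)) wrap₁

  colour : Fin 3 × Fin n → Fin K
  colour (a , j) = c (toℕ j) a

  rainbow : ∀ j → Rainbow (c (toℕ j))
  rainbow j = proj₁ (window (toℕ j) (toℕ<n j))

  step-disjoint : ∀ {i j} → Step n i j → i < n → Disjoint (c i) (c j)
  step-disjoint {i} s i<n = subst (Disjoint (c i)) (shift₀ s i<n) (proj₁ (proj₂ (window i i<n)))

  two-steps-distinct : ∀ {i j k} → Step n i j → Step n j k → i < n → j < n → RowDistinct (c i) (c k)
  two-steps-distinct {i} s t i<n j<n =
    subst (RowDistinct (c i)) (trans (shift₁ s i<n) (shift₀ t j<n)) (proj₂ (proj₂ (window i i<n)))

  adjacent-disjoint : ∀ {j l} → CycAdj n j l → Disjoint (c (toℕ j)) (c (toℕ l))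
  adjacent-disjoint {j} {l} jl with cycAdj⇒step jl
  ... | inj₁ s = step-disjoint s (toℕ<n j)
  ... | inj₂ s = disjoint-sym (step-disjoint s (toℕ<n l))

  distance-two : ∀ {j k l} → CycAdj n j k → CycAdj n k l → toℕ j ≢ toℕ l → RowDistinct (c (toℕ j)) (c (toℕ l))
  distance-two {j} {k} {l} jk kl j≢l with cycAdj⇒step jk | cycAdj⇒step kl
  ... | inj₁ s | inj₁ t = two-steps-distinct s t (toℕ<n j) (toℕ<n k)
  ... | inj₂ s | inj₂ t = rowDistinct-sym (two-steps-distinct t s (toℕ<n l) (toℕ<n k))
  ... | inj₁ s | inj₂ t = ⊥-elim (j≢l (step-injective {n} s t))
  ... | inj₂ s | inj₁ t = ⊥-elim (j≢l (step-functional s t (toℕ<n j) (toℕ<n l)))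

  -- Every edge of T_{3,n}² joins two vertices in one of the three situations above.
  colour-proper : ∀ u v → Adj (square (T3 n)) u v → colour u ≢ colour v
  colour-proper (a , j) (b , .j) (u≢v , inj₁ (inj₁ (_ , refl))) = rainbow j a b (λ a≡b → u≢v (cong (_, j) a≡b))
  colour-proper (a , j) (.a , l) (_ , inj₁ (inj₂ (refl , jl))) = adjacent-disjoint jl a a
  colour-proper (a , j) (b , .j) (u≢v , inj₂ ((a' , .j) , inj₁ (_ , refl) , inj₁ (_ , refl))) =
    rainbow j a b (λ a≡b → u≢v (cong (_, j) a≡b))
  colour-proper (a , j) (.a' , l) (_ , inj₂ ((a' , .j) , inj₁ (_ , refl) , inj₂ (refl , jl))) =
    adjacent-disjoint jl a a'
  colour-proper (a , j) (b , .k) (_ , inj₂ ((.a , k) , inj₂ (refl , jk) , inj₁ (_ , refl))) =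
    adjacent-disjoint jk a b
  colour-proper (a , j) (.a , l) (u≢v , inj₂ ((.a , k) , inj₂ (refl , jk) , inj₂ (refl , kl))) =
    distance-two jk kl (λ j≡l → u≢v (cong (a ,_) (toℕ-injective j≡l))) a

pattern-colouring : ∀ {K n} {c : ℕ → Column K} → CyclicPattern K n c → Colorable (square (T3 n)) K
pattern-colouring P = colour P , colour-proper P

-- Validity of windows is decidable, so explicit words can be checked by computation.
window? : ∀ {K} (x y z : Column K) → Dec (Window x y z)
window? x y z = rainbow? ×-dec disjoint? ×-dec rowDistinct?
  where
  rainbow? : Dec (Rainbow x)
  rainbow? = all? λ a → all? λ b → ¬? (a ≟ b) →-dec ¬? (x a ≟ x b)
  disjoint? : Dec (Disjoint x y)
  disjoint? = all? λ a → all? λ b → ¬? (x a ≟ y b)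
  rowDistinct? : Dec (RowDistinct x z)
  rowDistinct? = all? λ a → ¬? (x a ≟ z a)

Chain : ∀ {K m} → Vec (Column K) m → Set
Chain (x ∷ y ∷ z ∷ w) = Window x y z × Chain (y ∷ z ∷ w)
Chain _ = ⊤

chain? : ∀ {K m} (w : Vec (Column K) m) → Dec (Chain w)
chain? (x ∷ y ∷ z ∷ w) = window? x y z ×-dec chain? (y ∷ z ∷ w)
chain? [] = yes tt
chain? (_ ∷ []) = yes tt
chain? (_ ∷ _ ∷ []) = yes tt

-- The cyclic word x y w₁ … w_m describes n = m + 2 columns; it is valid when the windows
-- also wrap around the end.
record ValidCycle {K m} (x y : Column K) (w : Vec (Column K) m) : Set where
  constructor valid-cycle
  field chain : Chain (x ∷ y ∷ w ++ x ∷ y ∷ [])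

validCycle? : ∀ {K m} (x y : Column K) (w : Vec (Column K) m) → Dec (ValidCycle x y w)
validCycle? x y w = map′ valid-cycle ValidCycle.chain (chain? (x ∷ y ∷ w ++ x ∷ y ∷ []))

at : ∀ {A : Set} {m} → A → Vec A m → ℕ → A
at d [] _ = d
at d (x ∷ w) zero = x
at d (x ∷ w) (suc i) = at d w i

at-++ : ∀ {A : Set} {l m} (d : A) (u : Vec A l) {v : Vec A m} (i : ℕ) → at d (u ++ v) (l + i) ≡ at d v i
at-++ d [] i = refl
at-++ d (x ∷ u) i = at-++ d u i

chain-window : ∀ {K m} {d : Column K} (w : Vec (Column K) m) → Chain w →
               ∀ i → suc (suc i) < m → Window (at d w i) (at d w (suc i)) (at d w (suc (suc i)))
chain-window (x ∷ y ∷ z ∷ w) (valid , _) zero _ = valid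
chain-window (x ∷ y ∷ z ∷ w) (_ , rest) (suc i) (s≤s i<m) = chain-window (y ∷ z ∷ w) rest i i<m
chain-window (x ∷ y ∷ []) _ _ (s≤s (s≤s ()))
chain-window (x ∷ []) _ _ (s≤s ())
chain-window [] _ _ ()

cycle-pattern : ∀ {K m} {x y : Column K} {w : Vec (Column K) m} → ValidCycle x y w →
                CyclicPattern K (suc (suc m)) (at x (x ∷ y ∷ w ++ x ∷ y ∷ []))
cycle-pattern {m = m} {x} {y} {w} (valid-cycle valid) = record
  { window = λ i i<n → chain-window (x ∷ y ∷ w ++ x ∷ y ∷ []) valid i (s≤s (s≤s (subst (i <_) (+-comm 2 m) i<n)))
  ; wrap₀  = trans (cong (at x (w ++ x ∷ y ∷ [])) (sym (+-identityʳ m))) (at-++ x w 0)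
  ; wrap₁  = trans (cong (at x (w ++ x ∷ y ∷ [])) (+-comm 1 m)) (at-++ x w 1)
  }

cycle-colouring : ∀ {K m} {x y : Column K} {w : Vec (Column K) m} → ValidCycle x y w →
                  Colorable (square (T3 (suc (suc m)))) K
cycle-colouring valid = pattern-colouring (cycle-pattern valid)

insert-block : ∀ {K m} {x y b b' : Column K} {w : Vec (Column K) m} →
               ValidCycle x y (b ∷ b' ∷ []) → ValidCycle x y w → ValidCycle x y (b ∷ b' ∷ x ∷ y ∷ w)
insert-block (valid-cycle (xyb , ybb' , bb'x , b'xy , _)) (valid-cycle rest) =
  valid-cycle (xyb , ybb' , bb'x , b'xy , rest)

column : ∀ {K} → Fin K → Fin K → Fin K → Column K
column a b c fz = a
column a b c (fs fz) = b
column a b c (fs (fs fz)) = c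

c₀ c₁ c₃ : ∀ {k} → Column (6 + k)
c₀ = column (# 0) (# 1) (# 2)
c₁ = column (# 3) (# 4) (# 5)
c₃ = column (# 4) (# 5) (# 3)

-- Even n: 6 colours.  The 4-cycle c₀ c₁ c₂ c₃ is the block inserted repeatedly into itself
-- and into a 6-cycle.
c₂ : Column 6
c₂ = column (# 1) (# 2) (# 0)

even-block : ValidCycle c₀ c₁ (c₂ ∷ c₃ ∷ [])
even-block = from-yes (validCycle? c₀ c₁ (c₂ ∷ c₃ ∷ []))

even-word₆ : Vec (Column 6) 4
even-word₆ = c₂ ∷ c₃ ∷ column (# 2) (# 0) (# 1) ∷ column (# 5) (# 3) (# 4) ∷ []

even-cycles : ∀ h → Σ (Vec (Column 6) (suc (suc (h * 2)))) (ValidCycle c₀ c₁)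
even-cycles zero = c₂ ∷ c₃ ∷ [] , even-block
even-cycles (suc zero) = even-word₆ , from-yes (validCycle? c₀ c₁ even-word₆)
even-cycles (suc (suc h)) with even-cycles h
... | w , valid = c₂ ∷ c₃ ∷ c₀ ∷ c₁ ∷ w , insert-block even-block valid

even-colouring : ∀ h → Colorable (square (T3 (suc (suc h) * 2))) 6
even-colouring h = cycle-colouring (proj₂ (even-cycles h))

-- Odd n ≥ 7: 7 colours.  The 4-cycle c₀ c₁ d₂ c₃ is inserted into a 7-cycle and a 9-cycle.
d₂ : Column 7
d₂ = column (# 1) (# 0) (# 6)

odd-block : ValidCycle c₀ c₁ (d₂ ∷ c₃ ∷ [])
odd-block = from-yes (validCycle? c₀ c₁ (d₂ ∷ c₃ ∷ []))

odd-word₇ : Vec (Column 7) 5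
odd-word₇ = d₂ ∷ column (# 2) (# 3) (# 4) ∷ column (# 0) (# 6) (# 5) ∷ column (# 1) (# 2) (# 3)
          ∷ column (# 4) (# 5) (# 6) ∷ []

odd-word₉ : Vec (Column 7) 7
odd-word₉ = d₂ ∷ column (# 2) (# 3) (# 4) ∷ column (# 0) (# 1) (# 5) ∷ column (# 3) (# 2) (# 6)
          ∷ column (# 4) (# 5) (# 0) ∷ column (# 2) (# 3) (# 1) ∷ column (# 5) (# 6) (# 4) ∷ []

odd-cycles : ∀ h → Σ (Vec (Column 7) (5 + h * 2)) (ValidCycle c₀ c₁)
odd-cycles zero = odd-word₇ , from-yes (validCycle? c₀ c₁ odd-word₇)
odd-cycles (suc zero) = odd-word₉ , from-yes (validCycle? c₀ c₁ odd-word₉)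
odd-cycles (suc (suc h)) with odd-cycles h
... | w , valid = d₂ ∷ c₃ ∷ c₀ ∷ c₁ ∷ w , insert-block odd-block valid

odd-colouring : ∀ h → Colorable (square (T3 (suc (suc (suc (suc h)) * 2)))) 7
odd-colouring h = cycle-colouring (proj₂ (odd-cycles h))

word₅ : Vec (Column 8) 3
word₅ = column (# 1) (# 0) (# 6) ∷ column (# 2) (# 3) (# 4) ∷ column (# 5) (# 6) (# 7) ∷ []

colouring₅ : Colorable (square (T3 5)) 8
colouring₅ = cycle-colouring (from-yes (validCycle? c₀ c₁ word₅))

word₃ : Vec (Column 9) 1
word₃ = column (# 6) (# 7) (# 8) ∷ []

colouring₃ : Colorable (square (T3 3)) 9
colouring₃ = cycle-colouring (from-yes (validCycle? c₀ c₁ word₃))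

injection-bound : ∀ {A : Set} {k m} → Fin k ↔ A → {f : A → Fin m} → Injective _≡_ _≡_ f → k ≤ m
injection-bound e f-inj = injective⇒≤ (λ eq → Injection.injective (↔⇒↣ e) (f-inj eq))

[,]-injective : ∀ {A B C : Set} {f : A → C} {g : B → C} → Injective _≡_ _≡_ f → Injective _≡_ _≡_ g →
                (∀ a b → f a ≢ g b) → Injective _≡_ _≡_ [ f , g ]′
[,]-injective f-inj g-inj _ {inj₁ a} {inj₁ a'} eq = cong inj₁ (f-inj eq)
[,]-injective f-inj g-inj apart {inj₁ a} {inj₂ b} eq = ⊥-elim (apart a b eq)
[,]-injective f-inj g-inj apart {inj₂ b} {inj₁ a} eq = ⊥-elim (apart a b (sym eq))
[,]-injective f-inj g-inj _ {inj₂ b} {inj₂ b'} eq = cong inj₂ (g-inj eq)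

disjoint-bound : ∀ {A B : Set} {k l m} {f : A → Fin m} {g : B → Fin m} → Fin k ↔ A → Fin l ↔ B →
                 Injective _≡_ _≡_ f → Injective _≡_ _≡_ g → (∀ a b → f a ≢ g b) → k + l ≤ m
disjoint-bound eA eB f-inj g-inj apart = injection-bound ((eA ⊎-↔ eB) ↔-∘ +↔⊎) ([,]-injective f-inj g-inj apart)

clique-injective : ∀ {G : Graph} {m} {A : Set} (col : Colorable G m) (f : A → V G) → DecidableEquality A →
                   (∀ u v → u ≢ v → Adj G (f u) (f v)) → Injective _≡_ _≡_ (proj₁ col ∘ f)
clique-injective (c , proper) f _≟ᴬ_ clique {u} {v} eq =
  decidable-stable (u ≟ᴬ v) (λ u≢v → proper _ _ (clique u v u≢v) eq)

colourable-mono : ∀ {G : Graph} {m k} → m ≤ k → Colorable G m → Colorable G k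
colourable-mono m≤k (c , proper) =
  (λ v → inject≤ (c v) m≤k) , λ u v uv eq → proper u v uv (inject≤-injective m≤k m≤k _ _ eq)

non-colourable⇒bound : ∀ {G : Graph} {k} → ¬ Colorable G k → ∀ m → Colorable G m → suc k ≤ m
non-colourable⇒bound {k = k} ¬col m col with m ≤? k
... | yes m≤k = ⊥-elim (¬col (colourable-mono m≤k col))
... | no m≰k = ≰⇒> m≰k

C₃-complete : (a b : Fin 3) → a ≢ b → CycAdj 3 a b
C₃-complete fz fz a≢b = ⊥-elim (a≢b refl)
C₃-complete fz (fs fz) _ = inj₁ refl
C₃-complete fz (fs (fs fz)) _ = inj₂ (inj₂ (inj₁ (refl , refl)))
C₃-complete (fs fz) fz _ = inj₂ (inj₁ refl)
C₃-complete (fs fz) (fs fz) a≢b = ⊥-elim (a≢b refl)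
C₃-complete (fs fz) (fs (fs fz)) _ = inj₁ refl
C₃-complete (fs (fs fz)) fz _ = inj₂ (inj₂ (inj₂ (refl , refl)))
C₃-complete (fs (fs fz)) (fs fz) _ = inj₂ (inj₁ refl)
C₃-complete (fs (fs fz)) (fs (fs fz)) a≢b = ⊥-elim (a≢b refl)

cycAdj-sym : ∀ {n} {j l : Fin n} → CycAdj n j l → CycAdj n l j
cycAdj-sym (inj₁ e) = inj₂ (inj₁ e)
cycAdj-sym (inj₂ (inj₁ e)) = inj₁ e
cycAdj-sym (inj₂ (inj₂ (inj₁ p))) = inj₂ (inj₂ (inj₂ p))
cycAdj-sym (inj₂ (inj₂ (inj₂ p))) = inj₂ (inj₂ (inj₁ p))

-- Distinct vertices in the same or in adjacent columns are adjacent in T_{3,n}²: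
-- move within the column (C₃ is complete), then to the other column.
near-adjacent : ∀ {n} {a b : Fin 3} {j l : Fin n} → (a , j) ≢ (b , l) → j ≡ l ⊎ CycAdj n j l →
                Adj (square (T3 n)) (a , j) (b , l)
near-adjacent {a = a} {b} {j} u≢v (inj₁ refl) =
  u≢v , inj₁ (inj₁ (C₃-complete a b (λ a≡b → u≢v (cong (_, j) a≡b)) , refl))
near-adjacent {a = a} {b} {j} u≢v (inj₂ jl) with a ≟ b
... | yes refl = u≢v , inj₁ (inj₂ (refl , jl))
... | no a≢b = u≢v , inj₂ ((b , j) , inj₁ (C₃-complete a b a≢b , refl) , inj₂ (refl , jl))

neighbour-colours : ∀ {n m} {j l : Fin n} (col : Colorable (square (T3 n)) m) → CycAdj n j l → toℕ j ≢ toℕ l →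
                    ∀ a b → proj₁ col (a , j) ≢ proj₁ col (b , l)
neighbour-colours (_ , proper) jl j≢l a b = proper _ _ (near-adjacent (λ e → j≢l (cong (toℕ ∘ proj₂) e)) (inj₂ jl))

two-columns : ∀ {n} → Fin n → Fin n → Fin 3 × Fin 2 → Fin 3 × Fin n
two-columns j l (a , fz) = a , j
two-columns j l (a , fs fz) = a , l

two-columns-clique : ∀ {n} {j l : Fin n} → CycAdj n j l → toℕ j ≢ toℕ l →
                    ∀ u v → u ≢ v → Adj (square (T3 n)) (two-columns j l u) (two-columns j l v)
two-columns-clique jl j≢l (a , fz) (b , fz) u≢v =
  near-adjacent (λ e → u≢v (cong (_, fz) (cong proj₁ e))) (inj₁ refl)
two-columns-clique jl j≢l (a , fz) (b , fs fz) _ = near-adjacent (λ e → j≢l (cong (toℕ ∘ proj₂) e)) (inj₂ jl)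
two-columns-clique jl j≢l (a , fs fz) (b , fz) _ =
  near-adjacent (λ e → j≢l (cong (toℕ ∘ proj₂) (sym e))) (inj₂ (cycAdj-sym jl))
two-columns-clique jl j≢l (a , fs fz) (b , fs fz) u≢v =
  near-adjacent (λ e → u≢v (cong (_, fs fz) (cong proj₁ e))) (inj₁ refl)

two-columns-injective : ∀ {n m} {j l : Fin n} (col : Colorable (square (T3 n)) m) → CycAdj n j l → toℕ j ≢ toℕ l →
                       Injective _≡_ _≡_ (proj₁ col ∘ two-columns j l)
two-columns-injective col jl j≢l = clique-injective col _ (≡-dec _≟_ _≟_) (two-columns-clique jl j≢l)

six-lower-bound : ∀ n m → Colorable (square (T3 (suc (suc n)))) m → 6 ≤ m
six-lower-bound n m col = injection-bound *↔× (two-columns-injective {j = fz} {l = fs fz} col (inj₁ refl) λ ())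

beyond-two-columns : ∀ {n m l} {j k : Fin n} (col : Colorable (square (T3 n)) m) → CycAdj n j k → toℕ j ≢ toℕ k →
                     {g : Fin l → Fin m} → Injective _≡_ _≡_ g →
                     (∀ u i → proj₁ col (two-columns j k u) ≢ g i) → 6 + l ≤ m
beyond-two-columns {l = l} col jk j≢k g-inj apart =
  disjoint-bound *↔× (↔-id (Fin l)) (two-columns-injective col jk j≢k) g-inj apart

-- T_{3,3}² is complete, so χ(T_{3,3}²) ≥ 9.
nine-lower-bound : ∀ m → Colorable (square (T3 3)) m → 9 ≤ m
nine-lower-bound m col = injection-bound *↔× (clique-injective col (λ u → u) (≡-dec _≟_ _≟_) complete)
  where
  complete : ∀ u v → u ≢ v → Adj (square (T3 3)) u v
  complete (a , j) (b , l) u≢v with j ≟ l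
  ... | yes j≡l = near-adjacent u≢v (inj₁ j≡l)
  ... | no j≢l = near-adjacent u≢v (inj₂ (C₃-complete j l j≢l))

-- In a 6-colouring, the colour of a vertex in column j reappears in column l whenever
-- j, k, l are consecutive columns: k and l carry all six colours, and k avoids the colours of j.
six-colour-propagation : ∀ {n} {j k l : Fin n} (col : Colorable (square (T3 n)) 6) →
                         CycAdj n j k → toℕ j ≢ toℕ k → CycAdj n k l → toℕ k ≢ toℕ l →
                         ∀ a → ∃ λ b → proj₁ col (b , l) ≡ proj₁ col (a , j)
six-colour-propagation {j = j} {k} {l} col jk j≢k kl k≢l a
  with any? (λ b → proj₁ col (b , l) ≟ proj₁ col (a , j))
... | yes found = found
... | no missing = ⊥-elim (<-irrefl refl (beyond-two-columns col kl k≢l single apart))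
  where
  single : Injective _≡_ _≡_ (λ (_ : Fin 1) → proj₁ col (a , j))
  single {fz} {fz} _ = refl

  apart : ∀ u i → proj₁ col (two-columns k l u) ≢ proj₁ col (a , j)
  apart (b , fz) _ = neighbour-colours col (cycAdj-sym jk) (j≢k ∘ sym) b a
  apart (b , fs fz) _ eq = missing (b , eq)

-- Hence the colour of vertex (0, 0) appears in every even column; for odd n = 2h + 3 the last
-- column is even and adjacent to column 0, so T_{3,n}² is not 6-colourable.
odd-not-six : ∀ h → ¬ Colorable (square (T3 (suc (suc h * 2)))) 6
odd-not-six h col =
  let (a , ca≡x) = even-columns (suc h) last in neighbour-colours col wrap last≢0 fz a (sym ca≡x)
  where
  n : ℕ
  n = suc (suc h * 2)

  x : Fin 6
  x = proj₁ col (fz , fz)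

  step : ∀ {i} (p : i < n) (q : suc i < n) → CycAdj n (fromℕ< p) (fromℕ< q)
  step p q = inj₁ (trans (cong suc (toℕ-fromℕ< p)) (sym (toℕ-fromℕ< q)))

  step-distinct : ∀ {i} (p : i < n) (q : suc i < n) → toℕ (fromℕ< p) ≢ toℕ (fromℕ< q)
  step-distinct p q eq = 1+n≢n (sym (trans (sym (toℕ-fromℕ< p)) (trans eq (toℕ-fromℕ< q))))

  even-columns : ∀ k (p : k * 2 < n) → ∃ λ a → proj₁ col (a , fromℕ< p) ≡ x
  even-columns zero _ = fz , refl
  even-columns (suc k) p =
    let p₁ = <⇒≤ p
        p₀ = <⇒≤ p₁
        (a , ca≡x) = even-columns k p₀
        (b , cb≡ca) = six-colour-propagation col (step p₀ p₁) (step-distinct p₀ p₁)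
                                                 (step p₁ p) (step-distinct p₁ p) a
    in b , trans cb≡ca ca≡x

  last : suc h * 2 < n
  last = ≤-refl

  wrap : CycAdj n fz (fromℕ< last)
  wrap = inj₂ (inj₂ (inj₁ (refl , toℕ-fromℕ< last)))

  last≢0 : 0 ≢ toℕ (fromℕ< last)
  last≢0 eq with trans eq (toℕ-fromℕ< last)
  ... | ()

pair : ∀ {A : Set} → A → A → Fin 2 → A
pair x y fz = x
pair x y (fs fz) = y

pair-injective : ∀ {A : Set} {x y : A} → x ≢ y → Injective _≡_ _≡_ (pair x y)
pair-injective _ {fz} {fz} _ = refl
pair-injective x≢y {fz} {fs fz} eq = ⊥-elim (x≢y eq)
pair-injective x≢y {fs fz} {fz} eq = ⊥-elim (x≢y (sym eq))
pair-injective _ {fs fz} {fs fz} _ = refl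

-- Call a row of column 4 repeating if its colour occurs in
-- column 2.  Two repeating rows avoid the six colours of columns 0, 1; two non-repeating rows
-- avoid those of columns 2, 3; either way eight colours are needed, and two of the three rows
-- are alike.
module FiveColumns (col : Colorable (square (T3 5)) 7) where
  c : Fin 3 × Fin 5 → Fin 7
  c = proj₁ col

  Repeating : Fin 3 → Set
  Repeating a = ∃ λ b → c (a , # 4) ≡ c (b , # 2)

  crowded : ∀ {j k : Fin 5} {a a'} → CycAdj 5 j k → toℕ j ≢ toℕ k → a ≢ a' →
            (∀ u → c (two-columns j k u) ≢ c (a , # 4)) → (∀ u → c (two-columns j k u) ≢ c (a' , # 4)) → ⊥
  crowded {j} {k} {a} {a'} jk j≢k a≢a' avoid avoid' =
    <-irrefl refl (beyond-two-columns col jk j≢k (pair-injective different) apart)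
    where
    different : c (a , # 4) ≢ c (a' , # 4)
    different = proj₂ col _ _ (near-adjacent (λ e → a≢a' (cong proj₁ e)) (inj₁ refl))
    apart : ∀ u i → c (two-columns j k u) ≢ pair (c (a , # 4)) (c (a' , # 4)) i
    apart u fz = avoid u
    apart u (fs fz) = avoid' u

  -- Repeating rows avoid column 0 (a neighbour of column 4) and column 1 (a neighbour of column 2).
  both-repeating : ∀ {a a'} → a ≢ a' → Repeating a → Repeating a' → ⊥
  both-repeating a≢a' r r' = crowded (inj₁ refl) (λ ()) a≢a' (avoid r) (avoid r')
    where
    avoid : ∀ {a} → Repeating a → ∀ u → c (two-columns (# 0) (# 1) u) ≢ c (a , # 4)
    avoid {a} _ (b , fz) = neighbour-colours col (inj₂ (inj₂ (inj₁ (refl , refl)))) (λ ()) b a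
    avoid (b' , eq) (b , fs fz) e = neighbour-colours col (inj₁ refl) (λ ()) b b' (trans e eq)

  -- Non-repeating rows avoid column 2 by definition and column 3 (a neighbour of column 4).
  both-non-repeating : ∀ {a a'} → a ≢ a' → ¬ Repeating a → ¬ Repeating a' → ⊥
  both-non-repeating a≢a' r r' = crowded (inj₁ refl) (λ ()) a≢a' (avoid r) (avoid r')
    where
    avoid : ∀ {a} → ¬ Repeating a → ∀ u → c (two-columns (# 2) (# 3) u) ≢ c (a , # 4)
    avoid ¬r (b , fz) e = ¬r (b , sym e)
    avoid {a} _ (b , fs fz) = neighbour-colours col (inj₁ refl) (λ ()) b a

  repeating? : ∀ a → Dec (Repeating a)
  repeating? a = any? λ b → c (a , # 4) ≟ c (b , # 2)

  -- Two of the three rows of column 4 are alike.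
  absurd : ⊥
  absurd with repeating? (# 0) | repeating? (# 1) | repeating? (# 2)
  ... | yes r₀ | yes r₁ | _      = both-repeating (λ ()) r₀ r₁
  ... | no r₀  | no r₁  | _      = both-non-repeating (λ ()) r₀ r₁
  ... | yes r₀ | no _   | yes r₂ = both-repeating (λ ()) r₀ r₂
  ... | no _   | yes r₁ | yes r₂ = both-repeating (λ ()) r₁ r₂
  ... | yes _  | no r₁  | no r₂  = both-non-repeating (λ ()) r₁ r₂
  ... | no r₀  | yes _  | no r₂  = both-non-repeating (λ ()) r₀ r₂

five-not-seven : ¬ Colorable (square (T3 5)) 7
five-not-seven = FiveColumns.absurd

even-form : ∀ n → 3 ≤ n → 2 ∣ n → ∃ λ h → n ≡ suc (suc h) * 2
even-form _ () (divides zero refl)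
even-form _ (s≤s (s≤s ())) (divides (suc zero) refl)
even-form _ _ (divides (suc (suc h)) refl) = h , refl

odd-form : ∀ n → ¬ 2 ∣ n → ∃ λ h → n ≡ suc (h * 2)
odd-form n ¬2∣n = n / 2 , trans (m≡m%n+[m/n]*n n 2) (cong (_+ (n / 2) * 2) remainder)
  where
  remainder : n % 2 ≡ 1
  remainder with n % 2 | m%n<n n 2 | m%n≡0⇒n∣m n 2
  ... | zero | _ | 2∣n = ⊥-elim (¬2∣n (2∣n refl))
  ... | suc zero | _ | _ = refl
  ... | suc (suc _) | s≤s (s≤s ()) | _

odd≥7-form : ∀ n → 7 ≤ n → ¬ 2 ∣ n → ∃ λ h → n ≡ suc (suc (suc (suc h)) * 2)
odd≥7-form n 7≤n ¬2∣n with odd-form n ¬2∣n | 7≤n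
... | suc (suc (suc h)) , refl | _ = h , refl
... | zero , refl | s≤s ()
... | suc zero , refl | s≤s (s≤s (s≤s ()))
... | suc (suc zero) , refl | s≤s (s≤s (s≤s (s≤s (s≤s ()))))

theorem5 : ((n : ℕ) → 3 ≤ n → 2 ∣ n → ChromaticNumber (square (T3 n)) 6)
         × ((n : ℕ) → 7 ≤ n → ¬ (2 ∣ n) → ChromaticNumber (square (T3 n)) 7)
         × ChromaticNumber (square (T3 5)) 8
         × ChromaticNumber (square (T3 3)) 9
theorem5 = even-case , odd-case , (colouring₅ , non-colourable⇒bound five-not-seven)
                                , (colouring₃ , nine-lower-bound)
  where
  even-case : (n : ℕ) → 3 ≤ n → 2 ∣ n → ChromaticNumber (square (T3 n)) 6
  even-case n 3≤n 2∣n with even-form n 3≤n 2∣n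
  ... | h , refl = even-colouring h , six-lower-bound _

  odd-case : (n : ℕ) → 7 ≤ n → ¬ (2 ∣ n) → ChromaticNumber (square (T3 n)) 7
  odd-case n 7≤n ¬2∣n with odd≥7-form n 7≤n ¬2∣n
  ... | h , refl = odd-colouring h , non-colourable⇒bound (odd-not-six (suc (suc h)))
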